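{- Let $\widetilde{G}$ be a mixed graph with underlying graph $G$. Then $$-2d(G)\leqslant rk(\widetilde{G})-r(G)\leqslant 2d(G).$$
   Context: All graphs are finite, simple, without loops or multiple edges. A mixed graph $\widetilde{G}$ is obtained from a simple graph $G$ (its underlying graph) by orienting some of its edges; undirected edges are written $\{u,v\}$ and arcs $(u,v)$. The Hermitian adjacency matrix $H(\widetilde{G})=(h_{uv})$ is the $n\times n$ matrix with $h_{uv}=1$ if $\{u,v\}$ is an undirected edge, $h_{uv}=i$ if $(u,v)$ is an arc, $h_{uv}=-i$ if $(v,u)$ is an arc, and $h_{uv}=0$ otherwise. The $H$-rank $rk(\widetilde{G})$ is the rank of $H(\widetilde{G})$, and $r(G)$ is the rank of the adjacency matrix $A(G)$. $d(G)=|E_G|-|V_G|+\omega(G)$, where $\omega(G)$ is the number of connected components of $G$ (the dimension of the cycle space). -}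

module Defs where

open import Data.Nat as ℕ using (ℕ; zero; suc; _<ᵇ_)
open import Data.Integer as ℤ using (ℤ)
open import Data.Fin using (Fin; zero; suc; toℕ)
open import Data.Bool using (Bool; true; false; _∧_; if_then_else_)
open import Data.Product using (Σ; ∃; _×_)
open import Relation.Binary.PropositionalEquality using (_≡_)
open import Function.Definitions using (Injective)

record GI : Set where
  constructor gi
  field
    re : ℤ
    im : ℤ

open GI public

0G 1G iG -iG : GI
0G  = gi (ℤ.+ 0) (ℤ.+ 0)
1G  = gi (ℤ.+ 1) (ℤ.+ 0)
iG  = gi (ℤ.+ 0) (ℤ.+ 1)
-iG = gi (ℤ.+ 0) (ℤ.- ℤ.+ 1)

_+G_ : GI → GI → GI
gi a b +G gi c d = gi (a ℤ.+ c) (b ℤ.+ d)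

_*G_ : GI → GI → GI
gi a b *G gi c d = gi ((a ℤ.* c) ℤ.- (b ℤ.* d)) ((a ℤ.* d) ℤ.+ (b ℤ.* c))

∑G : ∀ {n} → (Fin n → GI) → GI
∑G {zero}  f = 0G
∑G {suc n} f = f zero +G ∑G (λ j → f (suc j))

∑ℕ : ∀ {n} → (Fin n → ℕ) → ℕ
∑ℕ {zero}  f = 0
∑ℕ {suc n} f = f zero ℕ.+ ∑ℕ (λ j → f (suc j))

Matrix : ℕ → Set
Matrix n = Fin n → Fin n → GI

RowsIndependent : ∀ {n m} → Matrix n → (Fin m → Fin n) → Set
RowsIndependent {n} {m} M s =
  (c : Fin m → GI) →
  (∀ col → ∑G (λ j → c j *G M (s j) col) ≡ 0G) →
  ∀ j → c j ≡ 0G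

IsRank : ∀ {n} → Matrix n → ℕ → Set
IsRank {n} M r =
  (Σ (Fin r → Fin n) λ s → Injective _≡_ _≡_ s × RowsIndependent M s)
  × (∀ m (s : Fin m → Fin n) → Injective _≡_ _≡_ s → RowsIndependent M s → m ℕ.≤ r)

-- Relation of an ordered pair (u,v):
--   none : no edge;  und : undirected edge {u,v};
--   out  : arc (u,v);  inn : arc (v,u).
data Entry : Set where
  none und out inn : Entry

rev : Entry → Entry
rev none = none
rev und  = und
rev out  = inn
rev inn  = out

record MixedGraph (n : ℕ) : Set where
  field
    ent      : Fin n → Fin n → Entry
    loopless : ∀ u → ent u u ≡ none
    symm     : ∀ u v → ent v u ≡ rev (ent u v)

open MixedGraph public

isEdge : Entry → Bool
isEdge none = false
isEdge _    = true

hentry : Entry → GI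
hentry none = 0G
hentry und  = 1G
hentry out  = iG
hentry inn  = -iG

Herm : ∀ {n} → MixedGraph n → Matrix n
Herm G u v = hentry (ent G u v)

Adj : ∀ {n} → MixedGraph n → Matrix n
Adj G u v = if isEdge (ent G u v) then 1G else 0G

Adjacent : ∀ {n} → MixedGraph n → Fin n → Fin n → Set
Adjacent G u v = isEdge (ent G u v) ≡ true

data Connected {n} (G : MixedGraph n) : Fin n → Fin n → Set where
  here : ∀ {u} → Connected G u u
  step : ∀ {u w v} → Adjacent G u w → Connected G w v → Connected G u v

numEdges : ∀ {n} → MixedGraph n → ℕ
numEdges G = ∑ℕ λ u → ∑ℕ λ v →
  if (toℕ u <ᵇ toℕ v) ∧ isEdge (ent G u v) then 1 else 0

IsNumComponents : ∀ {n} → MixedGraph n → ℕ → Set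
IsNumComponents {n} G k =
  Σ (Fin n → Fin k) λ f →
    (∀ j → ∃ λ v → f v ≡ j) ×
    (∀ u v → (f u ≡ f v → Connected G u v) × (Connected G u v → f u ≡ f v))

cyclomatic : ∀ {n} → MixedGraph n → ℕ → ℤ
cyclomatic {n} G ω = (ℤ.+ numEdges G ℤ.- ℤ.+ n) ℤ.+ ℤ.+ ω

-- Conjugating H by a diagonal matrix D of Gaussian units (switching, H ↦ D* H D) does not
-- change its rank.  Growing a spanning forest of G edge by edge, union–find style, and
-- rescaling each tree as it is attached, one finds a D for which every forest edge has entry 1
-- in D* H D.  This matrix then agrees with A(G) outside the rows of the endpoints of the
-- non-forest edges, of which there are |E| − n + (number of trees) ≤ d(G); changing k rows of a
-- matrix changes its rank by at most k.

module Submission where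

open import Defs
open import Data.Nat using (ℕ)
open import Data.Integer using (ℤ; +_; -_; _-_; _*_; _≤_)
open import Data.Product using (_×_)

open import Algebra.Bundles using (CommutativeMonoid)
open import Algebra.Structures.Biased using (isCommutativeMonoidˡ)
import Algebra.Properties.CommutativeSemigroup as CommutativeSemigroupProperties
import Algebra.Solver.CommutativeMonoid as CommutativeMonoidSolver
open import Data.Bool using (true; false; _∧_; if_then_else_)
open import Data.Bool.Properties using (T-≡)
open import Data.Fin using (Fin; zero; suc; punchIn; punchOut; toℕ; _≟_)
open import Data.Fin.Properties using (any?; suc-injective; punchIn-injective; punchInᵢ≢i; punchOut-injective; toℕ-injective)
import Data.Integer as ℤ
import Data.Integer.Properties as ℤ
open import Data.Integer.Solver using (module +-*-Solver)
open import Data.List using (List; []; _∷_; _++_; length)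
open import Data.List.Properties using (length-++)
open import Data.List.Membership.Propositional using (_∈_; _∉_)
open import Data.List.Membership.Propositional.Properties using (∈-++⁺ˡ; ∈-++⁺ʳ)
open import Data.List.Relation.Unary.All using (All; []; _∷_)
open import Data.List.Relation.Unary.All.Properties using (++⁺)
open import Data.List.Relation.Unary.Any using (here; there)
import Data.Nat as ℕ
import Data.Nat.Properties as ℕ
open import Data.Product as Prod using (Σ; _,_; proj₁; proj₂; uncurry)
open import Data.Sum as Sum using (_⊎_; inj₁; inj₂; [_,_])
open import Data.Vec.Functional using (insertAt; updateAt)
open import Data.Vec.Functional.Properties using (insertAt-lookup; insertAt-punchIn; updateAt-updates; updateAt-minimal)
open import Function using (_∘_; id; Equivalence)
open import Function.Definitions using (Injective)
open import Level using (0ℓ)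
open import Relation.Binary.Definitions using (tri<; tri≈; tri>)
open import Relation.Binary.PropositionalEquality
  using (_≡_; _≢_; refl; sym; trans; cong; cong₂; subst; isEquivalence; module ≡-Reasoning)
open import Relation.Nullary using (Dec; yes; no; ¬_; contradiction)
open import Relation.Unary using (Decidable)

-- Gaussian integers and their units

conjG : GI → GI
conjG (gi a b) = gi a (- b)

conjG-involutive : ∀ x → conjG (conjG x) ≡ x
conjG-involutive (gi a b) = cong (gi a) (ℤ.neg-involutive b)

module _ where
  open +-*-Solver

  *G-assoc : ∀ x y z → (x *G y) *G z ≡ x *G (y *G z)
  *G-assoc (gi a b) (gi c d) (gi e f) = cong₂ gi
    (solve 6 (λ a b c d e f → (a :* c :- b :* d) :* e :- (a :* d :+ b :* c) :* f
                          := a :* (c :* e :- d :* f) :- b :* (c :* f :+ d :* e)) refl a b c d e f)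
    (solve 6 (λ a b c d e f → (a :* c :- b :* d) :* f :+ (a :* d :+ b :* c) :* e
                          := a :* (c :* f :+ d :* e) :+ b :* (c :* e :- d :* f)) refl a b c d e f)

  *G-comm : ∀ x y → x *G y ≡ y *G x
  *G-comm (gi a b) (gi c d) = cong₂ gi
    (solve 4 (λ a b c d → a :* c :- b :* d := c :* a :- d :* b) refl a b c d)
    (solve 4 (λ a b c d → a :* d :+ b :* c := c :* b :+ d :* a) refl a b c d)

  *G-identityˡ : ∀ x → 1G *G x ≡ x
  *G-identityˡ (gi a b) = cong₂ gi
    (solve 2 (λ a b → con (+ 1) :* a :- con (+ 0) :* b := a) refl a b)
    (solve 2 (λ a b → con (+ 1) :* b :+ con (+ 0) :* a := b) refl a b)

  *G-distribʳ-+G : ∀ x y z → (x +G y) *G z ≡ (x *G z) +G (y *G z)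
  *G-distribʳ-+G (gi a b) (gi c d) (gi e f) = cong₂ gi
    (solve 6 (λ a b c d e f → (a :+ c) :* e :- (b :+ d) :* f
                          := (a :* e :- b :* f) :+ (c :* e :- d :* f)) refl a b c d e f)
    (solve 6 (λ a b c d e f → (a :+ c) :* f :+ (b :+ d) :* e
                          := (a :* f :+ b :* e) :+ (c :* f :+ d :* e)) refl a b c d e f)

  conjG-*G : ∀ x y → conjG (x *G y) ≡ conjG x *G conjG y
  conjG-*G (gi a b) (gi c d) = cong₂ gi
    (solve 4 (λ a b c d → a :* c :- b :* d := a :* c :- (:- b) :* (:- d)) refl a b c d)
    (solve 4 (λ a b c d → :- (a :* d :+ b :* c) := a :* (:- d) :+ (:- b) :* c) refl a b c d)

*G-zeroˡ : ∀ x → 0G *G x ≡ 0G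
*G-zeroˡ x = refl

+G-commutativeMonoid : CommutativeMonoid 0ℓ 0ℓ
+G-commutativeMonoid = record
  { Carrier = GI ; _≈_ = _≡_ ; _∙_ = _+G_ ; ε = 0G
  ; isCommutativeMonoid = isCommutativeMonoidˡ record
    { isSemigroup = record
      { isMagma = record { isEquivalence = isEquivalence ; ∙-cong = cong₂ _+G_ }
      ; assoc   = λ { (gi a b) (gi c d) (gi e f) → cong₂ gi (ℤ.+-assoc a c e) (ℤ.+-assoc b d f) } }
    ; identityˡ = λ { (gi a b) → cong₂ gi (ℤ.+-identityˡ a) (ℤ.+-identityˡ b) }
    ; comm      = λ { (gi a b) (gi c d) → cong₂ gi (ℤ.+-comm a c) (ℤ.+-comm b d) } } }

*G-commutativeMonoid : CommutativeMonoid 0ℓ 0ℓ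
*G-commutativeMonoid = record
  { Carrier = GI ; _≈_ = _≡_ ; _∙_ = _*G_ ; ε = 1G
  ; isCommutativeMonoid = isCommutativeMonoidˡ record
    { isSemigroup = record
      { isMagma = record { isEquivalence = isEquivalence ; ∙-cong = cong₂ _*G_ }
      ; assoc   = *G-assoc }
    ; identityˡ = *G-identityˡ
    ; comm      = *G-comm } }

open CommutativeMonoidSolver *G-commutativeMonoid using (solve; _⊜_; _⊕_) renaming (id to ε)
open CommutativeSemigroupProperties (CommutativeMonoid.commutativeSemigroup +G-commutativeMonoid)
  using () renaming (x∙yz≈y∙xz to +G-swapˡ)

*G-identityʳ : ∀ x → x *G 1G ≡ x
*G-identityʳ = solve 1 (λ x → x ⊕ ε ⊜ x) refl

*G-zeroʳ : ∀ x → x *G 0G ≡ 0G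
*G-zeroʳ x = trans (*G-comm x 0G) (*G-zeroˡ x)

IsUnit : GI → Set
IsUnit u = conjG u *G u ≡ 1G

unit-inverseʳ : ∀ {u} → IsUnit u → u *G conjG u ≡ 1G
unit-inverseʳ {u} u-unit = trans (*G-comm u (conjG u)) u-unit

conjG-unit : ∀ {u} → IsUnit u → IsUnit (conjG u)
conjG-unit {u} u-unit = trans (cong (_*G conjG u) (conjG-involutive u)) (unit-inverseʳ {u} u-unit)

*G-unit : ∀ {u v} → IsUnit u → IsUnit v → IsUnit (u *G v)
*G-unit {u} {v} u-unit v-unit = begin
  conjG (u *G v) *G (u *G v)              ≡⟨ cong (_*G (u *G v)) (conjG-*G u v) ⟩
  (conjG u *G conjG v) *G (u *G v)        ≡⟨ solve 4 (λ u′ v′ u v → (u′ ⊕ v′) ⊕ (u ⊕ v) ⊜ (u′ ⊕ u) ⊕ (v′ ⊕ v)) refl (conjG u) (conjG v) u v ⟩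
  (conjG u *G u) *G (conjG v *G v)        ≡⟨ cong₂ _*G_ u-unit v-unit ⟩
  1G ∎
  where open ≡-Reasoning

unit-cancelʳ : ∀ {u} y → IsUnit u → y *G u ≡ 0G → y ≡ 0G
unit-cancelʳ {u} y u-unit yu≡0 = begin
  y                           ≡⟨ sym (*G-identityʳ y) ⟩
  y *G 1G                     ≡⟨ cong (y *G_) u-unit ⟨
  y *G (conjG u *G u)         ≡⟨ solve 3 (λ y u u′ → y ⊕ (u′ ⊕ u) ⊜ (y ⊕ u) ⊕ u′) refl y u (conjG u) ⟩
  (y *G u) *G conjG u         ≡⟨ cong (_*G conjG u) yu≡0 ⟩
  0G                          ∎
  where open ≡-Reasoning

∑G-cong : ∀ {m} {f g : Fin m → GI} → (∀ j → f j ≡ g j) → ∑G f ≡ ∑G g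
∑G-cong {ℕ.zero}  f≗g = refl
∑G-cong {ℕ.suc m} f≗g = cong₂ _+G_ (f≗g zero) (∑G-cong (f≗g ∘ suc))

∑G-distribʳ : ∀ {m} (f : Fin m → GI) z → ∑G (λ j → f j *G z) ≡ ∑G f *G z
∑G-distribʳ {ℕ.zero}  f z = refl
∑G-distribʳ {ℕ.suc m} f z = begin
  (f zero *G z) +G ∑G (λ j → f (suc j) *G z)   ≡⟨ cong ((f zero *G z) +G_) (∑G-distribʳ (f ∘ suc) z) ⟩
  (f zero *G z) +G (∑G (f ∘ suc) *G z)         ≡⟨ *G-distribʳ-+G (f zero) (∑G (f ∘ suc)) z ⟨
  (f zero +G ∑G (f ∘ suc)) *G z                ∎
  where open ≡-Reasoning

∑G-punchIn : ∀ {m} (f : Fin (ℕ.suc m) → GI) i → ∑G f ≡ f i +G ∑G (f ∘ punchIn i)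
∑G-punchIn f zero = refl
∑G-punchIn {ℕ.suc m} f (suc i) = trans
  (cong (f zero +G_) (∑G-punchIn (f ∘ suc) i))
  (+G-swapˡ (f zero) (f (suc i)) _)

-- Switching and rank

switch : ∀ {n} → Matrix n → (Fin n → GI) → Matrix n
switch M φ u v = conjG (φ u) *G (M u v *G φ v)

switch-rescale : ∀ {n} (M : Matrix n) (φ ψ : Fin n → GI) u v →
  switch M (λ w → φ w *G ψ w) u v ≡ (conjG (ψ u) *G ψ v) *G switch M φ u v
switch-rescale M φ ψ u v = begin
  conjG (φ u *G ψ u) *G (M u v *G (φ v *G ψ v))
    ≡⟨ cong (_*G (M u v *G (φ v *G ψ v))) (conjG-*G (φ u) (ψ u)) ⟩
  (conjG (φ u) *G conjG (ψ u)) *G (M u v *G (φ v *G ψ v))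
    ≡⟨ solve 5 (λ a b m c d → (a ⊕ b) ⊕ (m ⊕ (c ⊕ d)) ⊜ (b ⊕ d) ⊕ (a ⊕ (m ⊕ c))) refl
               (conjG (φ u)) (conjG (ψ u)) (M u v) (φ v) (ψ v) ⟩
  (conjG (ψ u) *G ψ v) *G switch M φ u v
    ∎
  where open ≡-Reasoning

switch-hermitian : ∀ {n} (M : Matrix n) φ → (∀ u v → M u v ≡ conjG (M v u)) →
  ∀ u v → switch M φ u v ≡ conjG (switch M φ v u)
switch-hermitian M φ M-herm u v = begin
  conjG (φ u) *G (M u v *G φ v)
    ≡⟨ cong (λ m → conjG (φ u) *G (m *G φ v)) (M-herm u v) ⟩
  conjG (φ u) *G (conjG (M v u) *G φ v)
    ≡⟨ solve 3 (λ a m b → a ⊕ (m ⊕ b) ⊜ b ⊕ (m ⊕ a)) refl (conjG (φ u)) (conjG (M v u)) (φ v) ⟩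
  φ v *G (conjG (M v u) *G conjG (φ u))
    ≡⟨ cong (_*G (conjG (M v u) *G conjG (φ u))) (conjG-involutive (φ v)) ⟨
  conjG (conjG (φ v)) *G (conjG (M v u) *G conjG (φ u))
    ≡⟨ cong (conjG (conjG (φ v)) *G_) (conjG-*G (M v u) (φ u)) ⟨
  conjG (conjG (φ v)) *G conjG (M v u *G φ u)
    ≡⟨ conjG-*G (conjG (φ v)) (M v u *G φ u) ⟨
  conjG (conjG (φ v) *G (M v u *G φ u))
    ∎
  where open ≡-Reasoning

switch-conjG-inverse : ∀ {n} (M : Matrix n) {φ} → (∀ v → IsUnit (φ v)) →
  ∀ u v → switch (switch M φ) (conjG ∘ φ) u v ≡ M u v
switch-conjG-inverse M {φ} φ-unit u v = begin
  conjG (conjG (φ u)) *G ((conjG (φ u) *G (M u v *G φ v)) *G conjG (φ v))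
    ≡⟨ cong (_*G ((conjG (φ u) *G (M u v *G φ v)) *G conjG (φ v))) (conjG-involutive (φ u)) ⟩
  φ u *G ((conjG (φ u) *G (M u v *G φ v)) *G conjG (φ v))
    ≡⟨ solve 5 (λ a a′ m b b′ → a ⊕ ((a′ ⊕ (m ⊕ b)) ⊕ b′) ⊜ (a ⊕ a′) ⊕ ((b ⊕ b′) ⊕ m)) refl
               (φ u) (conjG (φ u)) (M u v) (φ v) (conjG (φ v)) ⟩
  (φ u *G conjG (φ u)) *G ((φ v *G conjG (φ v)) *G M u v)
    ≡⟨ cong₂ (λ x y → x *G (y *G M u v)) (unit-inverseʳ {φ u} (φ-unit u)) (unit-inverseʳ {φ v} (φ-unit v)) ⟩
  1G *G (1G *G M u v)
    ≡⟨ solve 1 (λ m → ε ⊕ (ε ⊕ m) ⊜ m) refl (M u v) ⟩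
  M u v
    ∎
  where open ≡-Reasoning

independent-cong : ∀ {n m} {M M′ : Matrix n} {s : Fin m → Fin n} →
  (∀ j col → M (s j) col ≡ M′ (s j) col) → RowsIndependent M s → RowsIndependent M′ s
independent-cong M≗M′ M-ind c c-rel = M-ind c λ col →
  trans (∑G-cong λ j → cong (c j *G_) (M≗M′ j col)) (c-rel col)

independent-switch : ∀ {n m} {M : Matrix n} {φ} {s : Fin m → Fin n} → (∀ v → IsUnit (φ v)) →
  RowsIndependent M s → RowsIndependent (switch M φ) s
independent-switch {m = m} {M} {φ} {s} φ-unit M-ind c c-rel j =
  unit-cancelʳ (c j) (conjG-unit {φ (s j)} (φ-unit (s j))) (M-ind c′ c′-rel j)
  where
  c′ : Fin m → GI
  c′ k = c k *G conjG (φ (s k))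
  c′-rel : ∀ col → ∑G (λ k → c′ k *G M (s k) col) ≡ 0G
  c′-rel col = unit-cancelʳ _ (φ-unit col) (begin
    ∑G (λ k → c′ k *G M (s k) col) *G φ col
      ≡⟨ ∑G-distribʳ (λ k → c′ k *G M (s k) col) (φ col) ⟨
    ∑G (λ k → (c′ k *G M (s k) col) *G φ col)
      ≡⟨ ∑G-cong (λ k → solve 4 (λ c a m b → ((c ⊕ a) ⊕ m) ⊕ b ⊜ c ⊕ (a ⊕ (m ⊕ b))) refl
                                  (c k) (conjG (φ (s k))) (M (s k) col) (φ col)) ⟩
    ∑G (λ k → c k *G switch M φ (s k) col)
      ≡⟨ c-rel col ⟩
    0G ∎)
    where open ≡-Reasoning

independent-unswitch : ∀ {n m} {M : Matrix n} {φ} {s : Fin m → Fin n} → (∀ v → IsUnit (φ v)) →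
  RowsIndependent (switch M φ) s → RowsIndependent M s
independent-unswitch {M = M} {φ} {s} φ-unit switched-ind =
  independent-cong {M = switch (switch M φ) (conjG ∘ φ)} {M′ = M} {s = s}
    (λ j col → switch-conjG-inverse M {φ} φ-unit (s j) col)
    (independent-switch {M = switch M φ} {conjG ∘ φ} {s} (λ v → conjG-unit {φ v} (φ-unit v)) switched-ind)

IsRank-switch : ∀ {n r} {M : Matrix n} {φ} → (∀ v → IsUnit (φ v)) → IsRank M r → IsRank (switch M φ) r
IsRank-switch {M = M} {φ} φ-unit ((s , s-inj , s-ind) , maximal) =
  (s , s-inj , independent-switch {M = M} {φ} φ-unit s-ind) ,
  λ m s′ s′-inj s′-ind → maximal m s′ s′-inj (independent-unswitch {M = M} {φ} φ-unit s′-ind)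

independent-punchIn : ∀ {n m} {M : Matrix n} {s : Fin (ℕ.suc m) → Fin n} i →
  RowsIndependent M s → RowsIndependent M (s ∘ punchIn i)
independent-punchIn {m = m} {M} {s} i M-ind c c-rel j = begin
  c j                  ≡⟨ insertAt-punchIn c i 0G j ⟨
  c₀ (punchIn i j)     ≡⟨ M-ind c₀ c₀-rel (punchIn i j) ⟩
  0G                   ∎
  where
  open ≡-Reasoning
  c₀ : Fin (ℕ.suc m) → GI
  c₀ = insertAt c i 0G
  c₀-rel : ∀ col → ∑G (λ k → c₀ k *G M (s k) col) ≡ 0G
  c₀-rel col = begin
    ∑G (λ k → c₀ k *G M (s k) col)
      ≡⟨ ∑G-punchIn (λ k → c₀ k *G M (s k) col) i ⟩
    (c₀ i *G M (s i) col) +G ∑G (λ k → c₀ (punchIn i k) *G M (s (punchIn i k)) col)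
      ≡⟨ cong₂ (λ x y → (x *G M (s i) col) +G y) (insertAt-lookup c i 0G)
               (∑G-cong λ k → cong (_*G M (s (punchIn i k)) col) (insertAt-punchIn c i 0G k)) ⟩
    (0G *G M (s i) col) +G ∑G (λ k → c k *G M (s (punchIn i k)) col)
      ≡⟨ cong ((0G *G M (s i) col) +G_) (c-rel col) ⟩
    (0G *G M (s i) col) +G 0G
      ≡⟨⟩
    0G ∎

record IndependentRows {n} (M : Matrix n) (m : ℕ) (avoided : List (Fin n)) : Set where
  field
    row         : Fin m → Fin n
    injective   : Injective _≡_ _≡_ row
    independent : RowsIndependent M row
    avoids      : ∀ j → row j ∉ avoided

open IndependentRows

avoid-row : ∀ {n m L} {M : Matrix n} u → IndependentRows M m L →
  Σ ℕ λ m′ → m ℕ.≤ ℕ.suc m′ × IndependentRows M m′ (u ∷ L)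
avoid-row {m = ℕ.zero} u R = 0 , ℕ.z≤n , record
  { row = row R ; injective = injective R ; independent = independent R ; avoids = λ () }
avoid-row {m = ℕ.suc m} {M = M} u R with any? (λ j → row R j ≟ u)
... | no u∉rows = ℕ.suc m , ℕ.n≤1+n _ , record
  { row         = row R
  ; injective   = injective R
  ; independent = independent R
  ; avoids = λ j → λ { (here eq) → u∉rows (j , eq) ; (there p) → avoids R j p } }
... | yes (i , row-i≡u) = m , ℕ.≤-refl , record
  { row         = row R ∘ punchIn i
  ; injective   = punchIn-injective i _ _ ∘ injective R
  ; independent = independent-punchIn {M = M} {row R} i (independent R)
  ; avoids      = λ j → λ
    { (here eq) → punchInᵢ≢i i j (injective R (trans eq (sym row-i≡u)))
    ; (there p) → avoids R (punchIn i j) p } }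

avoid-rows : ∀ {n m} {M : Matrix n} L → IndependentRows M m [] →
  Σ ℕ λ m′ → m ℕ.≤ length L ℕ.+ m′ × IndependentRows M m′ L
avoid-rows [] R = _ , ℕ.≤-refl , R
avoid-rows (u ∷ L) R =
  let (m′ , m≤L+m′ , R′)     = avoid-rows L R
      (m″ , m′≤1+m″ , R″)    = avoid-row u R′
  in m″ , ℕ.≤-trans m≤L+m′ (ℕ.≤-trans (ℕ.+-monoʳ-≤ (length L) m′≤1+m″) (ℕ.≤-reflexive (ℕ.+-suc _ m″))) , R″

rank-≤-differingRows+rank : ∀ {n r r′} {M M′ : Matrix n} (L : List (Fin n)) →
  (∀ u → u ∉ L → ∀ col → M u col ≡ M′ u col) → IsRank M r → IsRank M′ r′ → r ℕ.≤ length L ℕ.+ r′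
rank-≤-differingRows+rank {M = M} {M′} L agree ((s , s-inj , s-ind) , _) (_ , maximal′) =
  let (m , r≤L+m , R) = avoid-rows {M = M} L record { row = s ; injective = s-inj ; independent = s-ind ; avoids = λ _ () }
      R-ind′ = independent-cong {M = M} {M′} {row R} (λ j col → agree (row R j) (avoids R j) col) (independent R)
  in ℕ.≤-trans r≤L+m (ℕ.+-monoʳ-≤ (length L) (maximal′ m (row R) (injective R) R-ind′))

-- Counting and union–find relabelling

∑ℕ-cong : ∀ {m} {f g : Fin m → ℕ} → (∀ j → f j ≡ g j) → ∑ℕ f ≡ ∑ℕ g
∑ℕ-cong {ℕ.zero}  f≗g = refl
∑ℕ-cong {ℕ.suc m} f≗g = cong₂ ℕ._+_ (f≗g zero) (∑ℕ-cong (f≗g ∘ suc))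

∑ℕ-suc-at : ∀ {m} (f g : Fin m → ℕ) i → (∀ v → v ≢ i → f v ≡ g v) → f i ≡ ℕ.suc (g i) → ∑ℕ f ≡ ℕ.suc (∑ℕ g)
∑ℕ-suc-at f g zero agree fi = cong₂ ℕ._+_ fi (∑ℕ-cong λ j → agree (suc j) λ ())
∑ℕ-suc-at f g (suc i) agree fi = trans
  (cong₂ ℕ._+_ (agree zero λ ()) (∑ℕ-suc-at (f ∘ suc) (g ∘ suc) i (λ v v≢i → agree (suc v) (v≢i ∘ suc-injective)) fi))
  (ℕ.+-suc (g zero) _)

indicator : ∀ {P : Set} → Dec P → ℕ
indicator (yes _) = 1
indicator (no _)  = 0

indicator-yes : ∀ {P : Set} (P? : Dec P) → P → indicator P? ≡ 1
indicator-yes (yes _) _ = refl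
indicator-yes (no ¬p) p = contradiction p ¬p

indicator-no : ∀ {P : Set} (P? : Dec P) → ¬ P → indicator P? ≡ 0
indicator-no (yes p) ¬p = contradiction p ¬p
indicator-no (no _)  _  = refl

count : ∀ {m} {P : Fin m → Set} → Decidable P → ℕ
count P? = ∑ℕ (indicator ∘ P?)

count-universal : ∀ {m} {P : Fin m → Set} (P? : Decidable P) → (∀ v → P v) → count P? ≡ m
count-universal {ℕ.zero}  P? all = refl
count-universal {ℕ.suc m} P? all =
  cong₂ ℕ._+_ (indicator-yes (P? zero) (all zero)) (count-universal (P? ∘ suc) (all ∘ suc))

count-≤-injection : ∀ {m k} {P : Fin m → Set} (P? : Decidable P) (g : ∀ v → P v → Fin k) →
  (∀ {u v} (p : P u) (q : P v) → g u p ≡ g v q → u ≡ v) → count P? ℕ.≤ k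
count-≤-injection {ℕ.zero} P? g g-inj = ℕ.z≤n
count-≤-injection {ℕ.suc m} {ℕ.zero} P? g g-inj with P? zero
... | yes p₀ with () ← g zero p₀
... | no _ = count-≤-injection (P? ∘ suc) (g ∘ suc) λ p q → suc-injective ∘ g-inj p q
count-≤-injection {ℕ.suc m} {ℕ.suc k} {P} P? g g-inj with P? zero
... | no _ = count-≤-injection (P? ∘ suc) (g ∘ suc) λ p q → suc-injective ∘ g-inj p q
... | yes p₀ = ℕ.s≤s (count-≤-injection (P? ∘ suc) g′ g′-inj)
  where
  g₀≢ : ∀ {v} (q : P (suc v)) → g zero p₀ ≢ g (suc v) q
  g₀≢ q eq with () ← g-inj p₀ q eq
  g′ : ∀ v → P (suc v) → Fin k
  g′ v q = punchOut (g₀≢ q)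
  g′-inj : ∀ {u v} p q → g′ u p ≡ g′ v q → u ≡ v
  g′-inj p q eq = suc-injective (g-inj p q (punchOut-injective (g₀≢ p) (g₀≢ q) eq))

fixedPoints : ∀ {n} → (Fin n → Fin n) → ℕ
fixedPoints f = count (λ v → f v ≟ v)

redirect : ∀ {n} → Fin n → Fin n → Fin n → Fin n
redirect q p = updateAt (λ w → w) q (λ _ → p)

module Merge {n} {r : Fin n → Fin n} (r-idem : ∀ v → r (r v) ≡ r v) {a b} (r-a≢r-b : r a ≢ r b) where

  merged : Fin n → Fin n
  merged = redirect (r b) (r a) ∘ r

  merged-moved : ∀ {v} → r v ≡ r b → merged v ≡ r a
  merged-moved eq = trans (cong (redirect (r b) (r a)) eq) (updateAt-updates (r b) (λ w → w))

  merged-kept : ∀ {v} → r v ≢ r b → merged v ≡ r v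
  merged-kept {v} ne = updateAt-minimal (r v) (r b) (λ w → w) ne

  merged-∘-r : ∀ v → merged (r v) ≡ merged v
  merged-∘-r v = cong (redirect (r b) (r a)) (r-idem v)

  merged-idem : ∀ v → merged (merged v) ≡ merged v
  merged-idem v with r v ≟ r b
  ... | yes moved = begin
    merged (merged v)  ≡⟨ cong merged (merged-moved moved) ⟩
    merged (r a)       ≡⟨ merged-∘-r a ⟩
    merged a           ≡⟨ merged-kept r-a≢r-b ⟩
    r a                ≡⟨ merged-moved moved ⟨
    merged v           ∎
    where open ≡-Reasoning
  ... | no kept = trans (cong merged (merged-kept kept)) (merged-∘-r v)

  fixedPoints-merged : fixedPoints r ≡ ℕ.suc (fixedPoints merged)
  fixedPoints-merged = ∑ℕ-suc-at fixed fixed′ (r b) (λ v → same-status)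
    (trans (indicator-yes (r (r b) ≟ r b) (r-idem b)) (cong ℕ.suc (sym (indicator-no (merged (r b) ≟ r b) r-b-moved))))
    where
    open ≡-Reasoning
    fixed fixed′ : Fin n → ℕ
    fixed  v = indicator (r v ≟ v)
    fixed′ v = indicator (merged v ≟ v)
    r-b-moved : merged (r b) ≢ r b
    r-b-moved eq = r-a≢r-b (trans (sym (merged-moved {b} refl)) (trans (sym (merged-∘-r b)) eq))
    same-status : ∀ {v} → v ≢ r b → fixed v ≡ fixed′ v
    same-status {v} v≢r-b with r v ≟ r b
    ... | yes moved = trans (indicator-no (r v ≟ v) (λ eq → v≢r-b (trans (sym eq) moved)))
                            (sym (indicator-no (merged v ≟ v) λ eq → r-a≢r-b (begin
                               r a        ≡⟨ r-idem a ⟨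
                               r (r a)    ≡⟨ cong r (trans (sym (merged-moved moved)) eq) ⟩
                               r v        ≡⟨ moved ⟩
                               r b        ∎)))
    ... | no kept = cong (λ w → indicator (w ≟ v)) (sym (merged-kept kept))

module _ where
  open +-*-Solver renaming (solve to solveℤ)

  i≡[i+j]-j : ∀ i j → i ≡ (i ℤ.+ j) - j
  i≡[i+j]-j = solveℤ 2 (λ i j → i := (i :+ j) :- j) refl

  [i+j]-k≡[i-k]+j : ∀ i j k → (i ℤ.+ j) - k ≡ (i - k) ℤ.+ j
  [i+j]-k≡[i-k]+j = solveℤ 3 (λ i j k → (i :+ j) :- k := (i :- k) :+ j) refl

  -[j-i]≡i-j : ∀ i j → - (j - i) ≡ i - j
  -[j-i]≡i-j = solveℤ 2 (λ i j → :- (j :- i) := i :- j) refl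

bounded-difference : ∀ {a b k} {d : ℤ} → a ℕ.≤ k ℕ.+ b → b ℕ.≤ k ℕ.+ a → + k ≤ d →
  - d ≤ + a - + b × + a - + b ≤ d
bounded-difference {a} {b} {k} {d} a≤k+b b≤k+a k≤d = lower , difference-≤ a≤k+b
  where
  open ℤ.≤-Reasoning
  difference-≤ : ∀ {x y} → x ℕ.≤ k ℕ.+ y → + x - + y ≤ d
  difference-≤ {x} {y} x≤k+y = begin
    + x - + y             ≤⟨ ℤ.+-monoˡ-≤ (- + y) (ℤ.+≤+ x≤k+y) ⟩
    + (k ℕ.+ y) - + y     ≡⟨ cong (_- + y) (ℤ.pos-+ k y) ⟩
    (+ k ℤ.+ + y) - + y   ≡⟨ i≡[i+j]-j (+ k) (+ y) ⟨
    + k                   ≤⟨ k≤d ⟩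
    d                     ∎
  lower : - d ≤ + a - + b
  lower = begin
    - d                   ≤⟨ ℤ.neg-mono-≤ (difference-≤ b≤k+a) ⟩
    - (+ b - + a)         ≡⟨ -[j-i]≡i-j (+ a) (+ b) ⟩
    + a - + b             ∎

-- Switched spanning forests of a mixed graph

concatFin : ∀ {A : Set} {m} → (Fin m → List A) → List A
concatFin {m = ℕ.zero}  f = []
concatFin {m = ℕ.suc m} f = f zero ++ concatFin (f ∘ suc)

length-concatFin : ∀ {A : Set} {m} (f : Fin m → List A) → length (concatFin f) ≡ ∑ℕ (length ∘ f)
length-concatFin {m = ℕ.zero}  f = refl
length-concatFin {m = ℕ.suc m} f =
  trans (length-++ (f zero)) (cong (length (f zero) ℕ.+_) (length-concatFin (f ∘ suc)))

∈-concatFin : ∀ {A : Set} {m} {x : A} (f : Fin m → List A) j → x ∈ f j → x ∈ concatFin f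
∈-concatFin f zero    x∈ = ∈-++⁺ˡ x∈
∈-concatFin f (suc j) x∈ = ∈-++⁺ʳ (f zero) (∈-concatFin (f ∘ suc) j x∈)

All-concatFin : ∀ {A : Set} {P : A → Set} {m} (f : Fin m → List A) → (∀ j → All P (f j)) → All P (concatFin f)
All-concatFin {m = ℕ.zero}  f all = []
All-concatFin {m = ℕ.suc m} f all = ++⁺ (all zero) (All-concatFin (f ∘ suc) (all ∘ suc))

isEdge-rev : ∀ e → isEdge (rev e) ≡ isEdge e
isEdge-rev none = refl
isEdge-rev und  = refl
isEdge-rev out  = refl
isEdge-rev inn  = refl

module Edges {n} (G : MixedGraph n) where

  edgesAt : Fin n → Fin n → List (Fin n × Fin n)
  edgesAt u v = if (toℕ u ℕ.<ᵇ toℕ v) ∧ isEdge (ent G u v) then (u , v) ∷ [] else []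

  edges : List (Fin n × Fin n)
  edges = concatFin λ u → concatFin λ v → edgesAt u v

  length-edges : length edges ≡ numEdges G
  length-edges = trans (length-concatFin (λ u → concatFin (edgesAt u))) (∑ℕ-cong λ u →
                 trans (length-concatFin (edgesAt u)) (∑ℕ-cong (length-edgesAt u)))
    where
    length-edgesAt : ∀ u v → length (edgesAt u v) ≡ (if (toℕ u ℕ.<ᵇ toℕ v) ∧ isEdge (ent G u v) then 1 else 0)
    length-edgesAt u v with (toℕ u ℕ.<ᵇ toℕ v) ∧ isEdge (ent G u v)
    ... | true  = refl
    ... | false = refl

  edges-adjacent : All (uncurry (Adjacent G)) edges
  edges-adjacent = All-concatFin _ λ u → All-concatFin (edgesAt u) (edgesAt-adjacent u)
    where
    edgesAt-adjacent : ∀ u v → All (uncurry (Adjacent G)) (edgesAt u v)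
    edgesAt-adjacent u v with toℕ u ℕ.<ᵇ toℕ v | isEdge (ent G u v) in adj
    ... | true  | true  = adj ∷ []
    ... | true  | false = []
    ... | false | _     = []

  ∈-edges : ∀ {u v} → toℕ u ℕ.< toℕ v → Adjacent G u v → (u , v) ∈ edges
  ∈-edges {u} {v} u<v adj = ∈-concatFin (λ u → concatFin (edgesAt u)) u (∈-concatFin (edgesAt u) v ∈-edgesAt)
    where
    ∈-edgesAt : (u , v) ∈ edgesAt u v
    ∈-edgesAt rewrite Equivalence.to T-≡ (ℕ.<⇒<ᵇ u<v) | adj = here refl

  adjacent-sym : ∀ {u v} → Adjacent G u v → Adjacent G v u
  adjacent-sym {u} {v} adj = trans (cong isEdge (symm G u v)) (trans (isEdge-rev (ent G u v)) adj)

  adjacent⇒∈-edges : ∀ {u v} → Adjacent G u v → (u , v) ∈ edges ⊎ (v , u) ∈ edges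
  adjacent⇒∈-edges {u} {v} adj with ℕ.<-cmp (toℕ u) (toℕ v)
  ... | tri< u<v _ _ = inj₁ (∈-edges u<v adj)
  ... | tri> _ _ v<u = inj₂ (∈-edges v<u (adjacent-sym adj))
  ... | tri≈ _ u≡v _ with refl ← toℕ-injective u≡v
    with () ← trans (sym (cong isEdge (loopless G u))) adj

hentry-unit : ∀ {e} → isEdge e ≡ true → IsUnit (hentry e)
hentry-unit {und} _ = refl
hentry-unit {out} _ = refl
hentry-unit {inn} _ = refl

hentry-rev : ∀ e → hentry (rev e) ≡ conjG (hentry e)
hentry-rev none = refl
hentry-rev und  = refl
hentry-rev out  = refl
hentry-rev inn  = refl

Herm-hermitian : ∀ {n} (G : MixedGraph n) u v → Herm G u v ≡ conjG (Herm G v u)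
Herm-hermitian G u v = trans (cong hentry (symm G v u)) (hentry-rev (ent G v u))

switched-hentry≡adjacency : ∀ e {x y} → (isEdge e ≡ true → conjG x *G (hentry e *G y) ≡ 1G) →
  conjG x *G (hentry e *G y) ≡ (if isEdge e then 1G else 0G)
switched-hentry≡adjacency none {x} _ = *G-zeroʳ (conjG x)
switched-hentry≡adjacency und  norm = norm refl
switched-hentry≡adjacency out  norm = norm refl
switched-hentry≡adjacency inn  norm = norm refl

endpoints : ∀ {A : Set} → List (A × A) → List A
endpoints []             = []
endpoints ((a , b) ∷ ps) = a ∷ b ∷ endpoints ps

length-endpoints : ∀ {A : Set} (ps : List (A × A)) → length (endpoints ps) ≡ 2 ℕ.* length ps
length-endpoints []       = refl
length-endpoints (_ ∷ ps) = trans (cong (2 ℕ.+_) (length-endpoints ps)) (sym (ℕ.*-distribˡ-+ 2 1 (length ps)))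

∈-endpoints : ∀ {A : Set} {a b : A} {ps} → (a , b) ∈ ps → a ∈ endpoints ps × b ∈ endpoints ps
∈-endpoints {ps = _ ∷ _} (here refl) = here refl , there (here refl)
∈-endpoints {ps = _ ∷ _} (there p)   = Prod.map (there ∘ there) (there ∘ there) (∈-endpoints p)

module SwitchedForests {n} (G : MixedGraph n) where

  Normalised : (Fin n → GI) → Fin n → Fin n → Set
  Normalised φ u v = switch (Herm G) φ u v ≡ 1G

  normalised-sym : ∀ {φ u v} → Normalised φ u v → Normalised φ v u
  normalised-sym {φ} {u} {v} norm = trans (switch-hermitian (Herm G) φ (Herm-hermitian G) v u) (cong conjG norm)

  -- root v represents the tree containing v; the tree edges are those of es not in cotree, so
  -- size says that there are n − fixedPoints root of them.
  record SwitchedForest (es : List (Fin n × Fin n)) : Set where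
    field
      root       : Fin n → Fin n
      root-idem  : ∀ v → root (root v) ≡ root v
      phase      : Fin n → GI
      phase-unit : ∀ v → IsUnit (phase v)
      cotree     : List (Fin n × Fin n)
      size       : length cotree ℕ.+ n ≡ length es ℕ.+ fixedPoints root
      covers     : ∀ {u v} → (u , v) ∈ es → root u ≡ root v × (Normalised phase u v ⊎ (u , v) ∈ cotree)

  open SwitchedForest

  trivial-forest : SwitchedForest []
  trivial-forest = record
    { root       = id
    ; root-idem  = λ _ → refl
    ; phase      = λ _ → 1G
    ; phase-unit = λ _ → refl
    ; cotree     = []
    ; size       = sym (count-universal (λ v → v ≟ v) (λ _ → refl))
    ; covers     = λ ()
    }

  close-cycle : ∀ {es a b} (F : SwitchedForest es) → root F a ≡ root F b → SwitchedForest ((a , b) ∷ es)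
  close-cycle {a = a} {b} F same = record
    { root       = root F
    ; root-idem  = root-idem F
    ; phase      = phase F
    ; phase-unit = phase-unit F
    ; cotree     = (a , b) ∷ cotree F
    ; size       = cong ℕ.suc (size F)
    ; covers     = λ { (here refl) → same , inj₂ (here refl)
                     ; (there p)   → Prod.map₂ (Sum.map₂ there) (covers F p) }
    }

  -- The tree of b is rescaled by conjG w: this turns the entry of the new edge into 1 and,
  -- being constant on that tree, keeps the entries of its old edges.
  module Join {es a b} (F : SwitchedForest es) (adj : Adjacent G a b) (a≁b : root F a ≢ root F b) where
    open Merge (root-idem F) a≁b

    w : GI
    w = switch (Herm G) (phase F) a b

    w-unit : IsUnit w
    w-unit = *G-unit {conjG (phase F a)} (conjG-unit {phase F a} (phase-unit F a))
                     (*G-unit {hentry (ent G a b)} (hentry-unit adj) (phase-unit F b))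

    shift : Fin n → GI
    shift = updateAt (λ _ → 1G) (root F b) (λ _ → conjG w)

    shift-unit : ∀ x → IsUnit (shift x)
    shift-unit x with x ≟ root F b
    ... | yes refl = subst IsUnit (sym (updateAt-updates (root F b) (λ _ → 1G))) (conjG-unit {w} w-unit)
    ... | no x≢    = subst IsUnit (sym (updateAt-minimal x (root F b) (λ _ → 1G) x≢)) refl

    phase′ : Fin n → GI
    phase′ v = phase F v *G shift (root F v)

    rescaled : ∀ {u v} → root F u ≡ root F v → Normalised (phase F) u v → Normalised phase′ u v
    rescaled {u} {v} same norm = begin
      switch (Herm G) phase′ u v
        ≡⟨ switch-rescale (Herm G) (phase F) (shift ∘ root F) u v ⟩
      (conjG (shift (root F u)) *G shift (root F v)) *G switch (Herm G) (phase F) u v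
        ≡⟨ cong₂ _*G_ (trans (cong (λ x → conjG (shift (root F u)) *G shift x) (sym same)) (shift-unit (root F u))) norm ⟩
      1G ∎
      where open ≡-Reasoning

    joined-normalised : Normalised phase′ a b
    joined-normalised = begin
      switch (Herm G) phase′ a b
        ≡⟨ switch-rescale (Herm G) (phase F) (shift ∘ root F) a b ⟩
      (conjG (shift (root F a)) *G shift (root F b)) *G w
        ≡⟨ cong₂ (λ x y → (conjG x *G y) *G w) (updateAt-minimal (root F a) (root F b) (λ _ → 1G) a≁b)
                                                 (updateAt-updates (root F b) (λ _ → 1G)) ⟩
      (1G *G conjG w) *G w
        ≡⟨ cong (_*G w) (*G-identityˡ (conjG w)) ⟩
      conjG w *G w
        ≡⟨ w-unit ⟩
      1G ∎
      where open ≡-Reasoning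

    joined : SwitchedForest ((a , b) ∷ es)
    joined = record
      { root       = merged
      ; root-idem  = merged-idem
      ; phase      = phase′
      ; phase-unit = λ v → *G-unit {phase F v} (phase-unit F v) (shift-unit (root F v))
      ; cotree     = cotree F
      ; size       = trans (size F) (trans (cong (length es ℕ.+_) fixedPoints-merged) (ℕ.+-suc _ _))
      ; covers     = λ
        { (here refl) → trans (merged-kept a≁b) (sym (merged-moved refl)) , inj₁ joined-normalised
        ; (there p)   → let (same , norm) = covers F p
                        in cong (redirect (root F b) (root F a)) same , Sum.map₁ (rescaled same) norm }
      }

  extend : ∀ {es a b} → SwitchedForest es → Adjacent G a b → SwitchedForest ((a , b) ∷ es)
  extend {a = a} {b} F adj with root F a ≟ root F b
  ... | yes same  = close-cycle F same
  ... | no differ = Join.joined F adj differ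

  build : ∀ es → All (uncurry (Adjacent G)) es → SwitchedForest es
  build []             []           = trivial-forest
  build ((a , b) ∷ es) (adj ∷ adjs) = extend (build es adjs) adj

module SpanningForest {n} (G : MixedGraph n) where
  open Edges G
  open SwitchedForests G
  open SwitchedForest (build edges edges-adjacent) public

  root-adjacent : ∀ {u v} → Adjacent G u v → root u ≡ root v
  root-adjacent adj with adjacent⇒∈-edges adj
  ... | inj₁ uv∈ = proj₁ (covers uv∈)
  ... | inj₂ vu∈ = sym (proj₁ (covers vu∈))

  root-connected : ∀ {u v} → Connected G u v → root u ≡ root v
  root-connected here             = refl
  root-connected (step adj u~v)   = trans (root-adjacent adj) (root-connected u~v)

  fixedPoints-≤-components : ∀ {ω} → IsNumComponents G ω → fixedPoints root ℕ.≤ ω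
  fixedPoints-≤-components (component , _ , component-correct) =
    count-≤-injection (λ v → root v ≟ v) (λ v _ → component v) λ {u} {v} u-root v-root same-component →
      trans (sym u-root) (trans (root-connected (proj₁ (component-correct u v) same-component)) v-root)

  normalised-off-cotree : ∀ {u v} → u ∉ endpoints cotree → Adjacent G u v → Normalised phase u v
  normalised-off-cotree {u} {v} u∉ adj with adjacent⇒∈-edges adj
  ... | inj₁ uv∈ = [ id , (λ uv∈cotree → contradiction (proj₁ (∈-endpoints uv∈cotree)) u∉) ] (proj₂ (covers uv∈))
  ... | inj₂ vu∈ = [ normalised-sym {phase} {v} {u} , (λ vu∈cotree → contradiction (proj₂ (∈-endpoints vu∈cotree)) u∉) ] (proj₂ (covers vu∈))

  switched-row≡Adj-row : ∀ u → u ∉ endpoints cotree → ∀ v → switch (Herm G) phase u v ≡ Adj G u v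
  switched-row≡Adj-row u u∉ v = switched-hentry≡adjacency (ent G u v) {phase u} {phase v} (normalised-off-cotree {u} {v} u∉)

  cotree-≤-cyclomatic : ∀ {ω} → IsNumComponents G ω → + length cotree ≤ cyclomatic G ω
  cotree-≤-cyclomatic {ω} components = begin
    + c                                   ≡⟨ i≡[i+j]-j (+ c) (+ n) ⟩
    (+ c ℤ.+ + n) - + n                   ≡⟨ cong (_- + n) (ℤ.pos-+ c n) ⟨
    + (c ℕ.+ n) - + n                     ≡⟨ cong (λ k → + k - + n) (trans size (cong (ℕ._+ R) length-edges)) ⟩
    + (numEdges G ℕ.+ R) - + n            ≡⟨ cong (_- + n) (ℤ.pos-+ (numEdges G) R) ⟩
    (+ numEdges G ℤ.+ + R) - + n          ≡⟨ [i+j]-k≡[i-k]+j (+ numEdges G) (+ R) (+ n) ⟩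
    (+ numEdges G - + n) ℤ.+ + R          ≤⟨ ℤ.+-monoʳ-≤ (+ numEdges G - + n) (ℤ.+≤+ (fixedPoints-≤-components components)) ⟩
    (+ numEdges G - + n) ℤ.+ + ω          ∎
    where
    c R : ℕ
    c = length cotree
    R = fixedPoints root
    open ℤ.≤-Reasoning

theorem1p1 : (n : ℕ) (G : MixedGraph n) (ω rk r : ℕ) →
    IsNumComponents G ω → IsRank (Herm G) rk → IsRank (Adj G) r →
    (- (+ 2 * cyclomatic G ω) ≤ + rk - + r) × (+ rk - + r ≤ + 2 * cyclomatic G ω)
theorem1p1 n G ω rk r components rank-H rank-A = bounded-difference rk≤bad+r r≤bad+rk bad≤2d
  where
  open SpanningForest G
  bad : List (Fin n)
  bad = endpoints cotree
  rank-switched : IsRank (switch (Herm G) phase) rk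
  rank-switched = IsRank-switch {M = Herm G} {phase} phase-unit rank-H
  rk≤bad+r : rk ℕ.≤ length bad ℕ.+ r
  rk≤bad+r = rank-≤-differingRows+rank bad switched-row≡Adj-row rank-switched rank-A
  r≤bad+rk : r ℕ.≤ length bad ℕ.+ rk
  r≤bad+rk = rank-≤-differingRows+rank bad (λ u u∉ v → sym (switched-row≡Adj-row u u∉ v)) rank-A rank-switched
  bad≤2d : + length bad ≤ + 2 * cyclomatic G ω
  bad≤2d = begin
    + length bad             ≡⟨ cong +_ (length-endpoints cotree) ⟩
    + (2 ℕ.* length cotree)  ≡⟨ ℤ.pos-* 2 (length cotree) ⟩
    + 2 * + length cotree    ≤⟨ ℤ.*-monoˡ-≤-nonNeg (+ 2) (cotree-≤-cyclomatic components) ⟩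
    + 2 * cyclomatic G ω     ∎
    where open ℤ.≤-Reasoning
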